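{- Let $r\ge2$ and $\ell\ge2r$ be integers, and let $m=m_{r,\ell}$. Define $H$ on integers $q\in[0,m]$ by $H(q)=(m-q)(q)_{r-1}$. Then $H(q)<H(m-1)$ for all integers $q\in[0,m]\setminus\{m-1\}$.
   Context: For an integer $j$ and real $z$, $(z)_j=z(z-1)\cdots(z-j+1)$ if $z>j-1$ and $(z)_j=0$ otherwise. $m_{r,\ell}$ is the unique integer $k\ge r$ maximizing $f(k)=\frac{(k-1)_{r-1}}{k^{\ell-1}}$ over integers $k\ge r$. -}

module Defs where

open import Data.Nat using (ℕ; _+_; _*_; _∸_; _^_; _≤_; _<_; _≥_)
open import Data.Nat.Combinatorics using (_P_)
open import Relation.Binary.PropositionalEquality using (_≡_)
open import Relation.Nullary using (¬_)

-- Falling factorial (z)_j for natural z: z(z-1)...(z-j+1) if z > j-1, else 0.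
-- This is exactly stdlib's  z P j  (= if j ≤ z then product else 0).
ff : ℕ → ℕ → ℕ
ff z j = z P j

-- f(k) = (k-1)_{r-1} / k^{ℓ-1}.  For k, k' ≥ r ≥ 2 both denominators are
-- positive, so  f(k) < f(k')  iff  (k-1)_{r-1} * k'^{ℓ-1} < (k'-1)_{r-1} * k^{ℓ-1}.
fLt : (r ℓ k k' : ℕ) → Set
fLt r ℓ k k' = ff (k ∸ 1) (r ∸ 1) * k' ^ (ℓ ∸ 1) < ff (k' ∸ 1) (r ∸ 1) * k ^ (ℓ ∸ 1)

-- m is m_{r,ℓ}: the unique integer k ≥ r maximizing f over integers k ≥ r
-- (i.e. m ≥ r and f(k) < f(m) for every integer k ≥ r with k ≠ m).
IsMrl : (r ℓ m : ℕ) → Set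
IsMrl r ℓ m = r ≤ m × ((k : ℕ) → r ≤ k → ¬ (k ≡ m) → fLt r ℓ k m)
  where open import Data.Product using (_×_)

-- H(q) = (m - q) (q)_{r-1}   (used for 0 ≤ q ≤ m, so m ∸ q = m - q)
H : (r m q : ℕ) → ℕ
H r m q = (m ∸ q) * ff q (r ∸ 1)

{-# OPTIONS --safe #-}
module Submission where

-- Write a = r - 1 and n = ℓ - 1, so f(k) = (k-1)_a / k^n and H(q) = (m - q) (q)_a.
-- First, m ≤ 2a: for k ≥ 2a the ratio f(k+1)/f(k) = (k/(k+1))^n · k/(k-a) is at most 1,
-- since Bernoulli gives k^n (k+n) ≤ k (k+1)^n and n ≥ 2a+1 gives k² ≤ (k+n)(k-a).
-- Second, for a ≤ q ≤ m-2 the ratio H(q+1)/H(q) = (m-q-1)(q+1) / ((m-q)(q+1-a)) exceeds 1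
-- because m ≤ 2a, so H increases strictly up to m-1; below a the falling factorial
-- vanishes, and H(m) = 0.

open import Defs
open import Data.Nat using (ℕ; _*_; _∸_; _≤_; _<_)
open import Relation.Binary.PropositionalEquality using (_≡_)
open import Relation.Nullary using (¬_)

open import Algebra.Properties.CommutativeSemigroup using (x∙yz≈y∙xz)
open import Data.Bool.Base using (T; true; false)
open import Data.Nat.Base using (zero; suc; _+_; _^_; _≤ᵇ_; z≤n; s≤s; z<s; NonZero; >-nonZero)
open import Data.Nat.Combinatorics.Base using (_P′_; _P_)
open import Data.Nat.Combinatorics.Specification using (k>n⇒nPk≡0)
open import Data.Nat.Properties
open import Data.Nat.Tactic.RingSolver using (solve-∀)
open import Data.Product using (_,_)
open import Data.Sum using (inj₁; inj₂)
open import Relation.Nullary using (yes; no; contradiction)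
open import Relation.Binary.PropositionalEquality using (_≢_; refl; sym; trans; cong; subst; module ≡-Reasoning)

k≤n⇒nPk≡nP′k : ∀ {n k} → k ≤ n → n P k ≡ n P′ k
k≤n⇒nPk≡nP′k {n} {k} k≤n with k ≤ᵇ n in eq
... | true  = refl
... | false = contradiction (≤⇒≤ᵇ k≤n) (subst T eq)

nP[1+k]≡[n∸k]*nPk : ∀ n k → n P suc k ≡ (n ∸ k) * (n P k)
nP[1+k]≡[n∸k]*nPk n k with k <? n
... | yes k<n = trans (k≤n⇒nPk≡nP′k k<n) (cong ((n ∸ k) *_) (sym (k≤n⇒nPk≡nP′k (<⇒≤ k<n))))
... | no  k≮n = trans (k>n⇒nPk≡0 (s≤s (≮⇒≥ k≮n)))
                      (cong (_* (n P k)) (sym (m≤n⇒m∸n≡0 (≮⇒≥ k≮n))))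

[1+n]P[1+k]≡[1+n]*nPk : ∀ n k → suc n P suc k ≡ suc n * (n P k)
[1+n]P[1+k]≡[1+n]*nPk n zero    = refl
[1+n]P[1+k]≡[1+n]*nPk n (suc k) = begin
  suc n P suc (suc k)         ≡⟨ nP[1+k]≡[n∸k]*nPk (suc n) (suc k) ⟩
  (n ∸ k) * (suc n P suc k)   ≡⟨ cong ((n ∸ k) *_) ([1+n]P[1+k]≡[1+n]*nPk n k) ⟩
  (n ∸ k) * (suc n * (n P k)) ≡⟨ x∙yz≈y∙xz *-commutativeSemigroup (n ∸ k) (suc n) (n P k) ⟩
  suc n * ((n ∸ k) * (n P k)) ≡⟨ cong (suc n *_) (nP[1+k]≡[n∸k]*nPk n k) ⟨
  suc n * (n P suc k)         ∎
  where open ≡-Reasoning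

[1+n∸k]*[1+n]Pk≡[1+n]*nPk : ∀ n k → (suc n ∸ k) * (suc n P k) ≡ suc n * (n P k)
[1+n∸k]*[1+n]Pk≡[1+n]*nPk n k = trans (sym (nP[1+k]≡[n∸k]*nPk (suc n) k)) ([1+n]P[1+k]≡[1+n]*nPk n k)

k≤n⇒0<nPk : ∀ {n k} → k ≤ n → 0 < n P k
k≤n⇒0<nPk {n}     {zero}  _         = z<s
k≤n⇒0<nPk {suc n} {suc k} (s≤s k≤n) =
  subst (0 <_) (sym ([1+n]P[1+k]≡[1+n]*nPk n k)) (*-mono-< (z<s {n}) (k≤n⇒0<nPk k≤n))

bernoulli : ∀ k n → k ^ n * (k + n) ≤ k * suc k ^ n
bernoulli k zero    = ≤-reflexive (unit k)
  where
  unit : ∀ k → 1 * (k + 0) ≡ k * 1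
  unit = solve-∀
bernoulli k (suc n) = begin
  k ^ suc n * (k + suc n)             ≡⟨ expand k (k ^ n) n ⟩
  k * (k ^ n * (k + n)) + k ^ n * k   ≤⟨ +-mono-≤ (*-monoʳ-≤ k (bernoulli k n))
                                                  (≤-trans (*-monoʳ-≤ (k ^ n) (m≤m+n k n)) (bernoulli k n)) ⟩
  k * (k * suc k ^ n) + k * suc k ^ n ≡⟨ collect k (suc k ^ n) ⟩
  k * suc k ^ suc n                   ∎
  where
  open ≤-Reasoning
  expand : ∀ k x n → k * x * (k + suc n) ≡ k * (x * (k + n)) + x * k
  expand = solve-∀
  collect : ∀ k y → k * (k * y) + k * y ≡ k * (suc k * y)
  collect = solve-∀

k²≤[k+n]b : ∀ {a b k n} → a ≤ b → a + b ≡ k → suc (a + a) ≤ n → k * k ≤ (k + n) * b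
k²≤[k+n]b {a} a≤b refl 2a<n with m≤n⇒∃[o]m+o≡n a≤b | m≤n⇒∃[o]m+o≡n 2a<n
... | t , refl | s , refl = ≤-trans (m≤m+n _ _) (≤-reflexive (sym (expand a t s)))
  where
  expand : ∀ a t s → ((a + (a + t)) + (suc (a + a) + s)) * (a + t)
                     ≡ (a + (a + t)) * (a + (a + t)) + (a * t + a + t + s * a + s * t)
  expand = solve-∀

k²≤[k+n]b⇒k^[2+n]≤[1+k]^n*kb : ∀ {k n b} → k * k ≤ (k + n) * b → k ^ (2 + n) ≤ suc k ^ n * (k * b)
k²≤[k+n]b⇒k^[2+n]≤[1+k]^n*kb {k} {n} {b} k²≤[k+n]b = begin
  k * (k * k ^ n)       ≡⟨ regroup₁ k (k ^ n) ⟩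
  k ^ n * (k * k)       ≤⟨ *-monoʳ-≤ (k ^ n) k²≤[k+n]b ⟩
  k ^ n * ((k + n) * b) ≡⟨ *-assoc (k ^ n) (k + n) b ⟨
  k ^ n * (k + n) * b   ≤⟨ *-monoˡ-≤ b (bernoulli k n) ⟩
  k * suc k ^ n * b     ≡⟨ regroup₂ k (suc k ^ n) b ⟩
  suc k ^ n * (k * b)   ∎
  where
  open ≤-Reasoning
  regroup₁ : ∀ k x → k * (k * x) ≡ x * (k * k)
  regroup₁ = solve-∀
  regroup₂ : ∀ k y b → k * y * b ≡ y * (k * b)
  regroup₂ = solve-∀

f-antitone : ∀ {a n k} → a < k → a + a ≤ k → suc (a + a) ≤ n → ¬ fLt (suc a) (suc n) k (suc k)
f-antitone {a} {n} {suc j} (s≤s a≤j) 2a≤k 2a<n = ≤⇒≯ (*-cancelʳ-≤ _ _ (k * b) {{kb≢0}} (begin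
  (k P a) * k ^ n * (k * b)     ≡⟨ regroup₁ (k P a) (k ^ n) k b ⟩
  b * (k P a) * (k * k ^ n)     ≡⟨ cong (_* (k * k ^ n)) ([1+n∸k]*[1+n]Pk≡[1+n]*nPk j a) ⟩
  k * (j P a) * (k * k ^ n)     ≡⟨ regroup₂ k (j P a) (k ^ n) ⟩
  (j P a) * (k * (k * k ^ n))   ≤⟨ *-monoʳ-≤ (j P a) (k²≤[k+n]b⇒k^[2+n]≤[1+k]^n*kb {k} {n} (k²≤[k+n]b a≤b a+b≡k 2a<n)) ⟩
  (j P a) * (suc k ^ n * (k * b)) ≡⟨ *-assoc (j P a) (suc k ^ n) (k * b) ⟨
  (j P a) * suc k ^ n * (k * b) ∎))
  where
  open ≤-Reasoning
  k b : ℕ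
  k = suc j
  b = k ∸ a
  kb≢0 : NonZero (k * b)
  kb≢0 = m*n≢0 k b {{_}} {{>-nonZero (m<n⇒0<n∸m (s≤s a≤j))}}
  a+b≡k : a + b ≡ k
  a+b≡k = m+[n∸m]≡n (m≤n⇒m≤1+n a≤j)
  a≤b : a ≤ b
  a≤b = +-cancelˡ-≤ a a b (subst (a + a ≤_) (sym a+b≡k) 2a≤k)
  regroup₁ : ∀ p x k b → p * x * (k * b) ≡ b * p * (k * x)
  regroup₁ = solve-∀
  regroup₂ : ∀ k p x → k * p * (k * x) ≡ p * (k * (k * x))
  regroup₂ = solve-∀

IsMrl⇒≤2[r∸1] : ∀ {a n} m → 1 ≤ a → suc (a + a) ≤ n → IsMrl (suc a) (suc n) m → m ≤ a + a
IsMrl⇒≤2[r∸1]     zero    _   _    _             = z≤n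
IsMrl⇒≤2[r∸1] {a} (suc k) 1≤a 2a<n (_ , maximal) = ≮⇒≥ λ { (s≤s 2a≤k) →
  let r≤k = ≤-trans (+-monoˡ-≤ a 1≤a) 2a≤k in
  f-antitone r≤k 2a≤k 2a<n (maximal k r≤k (<⇒≢ (n<1+n k))) }

stepwise-increasing⇒< : ∀ (f : ℕ → ℕ) {lo q} hi → (∀ {i} → lo ≤ i → i < hi → f i < f (suc i)) →
                        lo ≤ q → q < hi → f q < f hi
stepwise-increasing⇒< f (suc h) step lo≤q q<1+h with m<1+n⇒m<n∨m≡n q<1+h
... | inj₂ refl = step lo≤q ≤-refl
... | inj₁ q<h  = <-trans (stepwise-increasing⇒< f h (λ lo≤i i<h → step lo≤i (m<n⇒m<1+n i<h)) lo≤q q<h)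
                          (step (≤-trans lo≤q (<⇒≤ q<h)) ≤-refl)

s[1+d]<d[a+s] : ∀ {s d a} → 1 ≤ d → s + d ≤ a → s * suc d < d * (a + s)
s[1+d]<d[a+s] {s} {d@(suc _)} {a} _ s+d≤a = begin-strict
  s * suc d               ≡⟨ *-suc s d ⟩
  s + s * d               ≤⟨ +-monoˡ-≤ (s * d) (m≤n*m s d) ⟩
  d * s + s * d           <⟨ m<n+m (d * s + s * d) {d * d} z<s ⟩
  d * d + (d * s + s * d) ≡⟨ collect d s ⟩
  d * (d + s + s)         ≤⟨ *-monoʳ-≤ d (+-monoˡ-≤ s (subst (_≤ a) (+-comm s d) s+d≤a)) ⟩
  d * (a + s)             ∎
  where
  open ≤-Reasoning
  collect : ∀ d s → d * d + (d * s + s * d) ≡ d * (d + s + s)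
  collect = solve-∀

H-step : ∀ {a q m} → a ≤ q → suc q < m → m ≤ a + a → H (suc a) m q < H (suc a) m (suc q)
H-step {a} {q} {m} a≤q 1+q<m m≤2a = *-cancelˡ-< s _ _ (begin-strict
  s * ((m ∸ q) * (q P a))  ≡⟨ cong (λ x → s * (x * (q P a))) (+-∸-assoc 1 (<⇒≤ 1+q<m)) ⟩
  s * (suc d * (q P a))    ≡⟨ *-assoc s (suc d) (q P a) ⟨
  s * suc d * (q P a)      <⟨ *-monoˡ-< (q P a) {{>-nonZero (k≤n⇒0<nPk a≤q)}}
                                (s[1+d]<d[a+s] (m<n⇒0<n∸m 1+q<m) s+d≤a) ⟩
  d * (a + s) * (q P a)    ≡⟨ cong (λ x → d * x * (q P a)) a+s≡1+q ⟩
  d * suc q * (q P a)      ≡⟨ *-assoc d (suc q) (q P a) ⟩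
  d * (suc q * (q P a))    ≡⟨ cong (d *_) ([1+n∸k]*[1+n]Pk≡[1+n]*nPk q a) ⟨
  d * (s * (suc q P a))    ≡⟨ x∙yz≈y∙xz *-commutativeSemigroup d s (suc q P a) ⟩
  s * (d * (suc q P a))    ∎)
  where
  open ≤-Reasoning
  s d : ℕ
  s = suc q ∸ a
  d = m ∸ suc q
  a+s≡1+q : a + s ≡ suc q
  a+s≡1+q = m+[n∸m]≡n (m≤n⇒m≤1+n a≤q)
  s+d≤a : s + d ≤ a
  s+d≤a = +-cancelˡ-≤ a (s + d) a (begin
    a + (s + d) ≡⟨ +-assoc a s d ⟨
    a + s + d   ≡⟨ cong (_+ d) a+s≡1+q ⟩
    suc q + d   ≡⟨ m+[n∸m]≡n (<⇒≤ 1+q<m) ⟩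
    m           ≤⟨ m≤2a ⟩
    a + a       ∎)

0<H[m∸1] : ∀ {a m} → a ≤ m → 0 < H (suc a) (suc m) m
0<H[m∸1] {a} {m} a≤m = *-mono-< (m<n⇒0<n∸m (n<1+n m)) (k≤n⇒0<nPk a≤m)

H<H[m∸1] : ∀ {a m q} → a ≤ m → suc m ≤ a + a → q ≤ suc m → q ≢ m →
           H (suc a) (suc m) q < H (suc a) (suc m) m
H<H[m∸1] {a} {m} {q} a≤m 1+m≤2a q≤1+m q≢m with m≤n⇒m<n∨m≡n q≤1+m
... | inj₂ refl = ≤-<-trans (≤-reflexive (cong (_* (suc m P a)) (n∸n≡0 m))) (0<H[m∸1] a≤m)
... | inj₁ (s≤s q≤m) with a ≤? q
...   | yes a≤q = stepwise-increasing⇒< (H (suc a) (suc m)) m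
                    (λ a≤i i<m → H-step a≤i (s≤s i<m) 1+m≤2a) a≤q (≤∧≢⇒< q≤m q≢m)
...   | no  a≰q = ≤-<-trans (≤-reflexive (trans (cong ((suc m ∸ q) *_) (k>n⇒nPk≡0 (≰⇒> a≰q)))
                                                (*-zeroʳ (suc m ∸ q))))
                            (0<H[m∸1] a≤m)

lemma4p4 : (r ℓ m : ℕ) → 2 ≤ r → 2 * r ≤ ℓ → IsMrl r ℓ m →
    (q : ℕ) → q ≤ m → ¬ (q ≡ m ∸ 1) → H r m q < H r m (m ∸ 1)
lemma4p4 (suc a) (suc n) (suc m) (s≤s 1≤a) (s≤s 2a<n′) mrl@(s≤s a≤m , _) q q≤1+m q≢m =
  H<H[m∸1] a≤m (IsMrl⇒≤2[r∸1] (suc m) 1≤a 2a<n mrl) q≤1+m q≢m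
  where
  2a<n : suc (a + a) ≤ n
  2a<n = subst (_≤ n) (trans (+-suc a (a + 0)) (cong (λ x → suc (a + x)) (+-identityʳ a))) 2a<n′
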